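{- Let $H=(V,E)$ be a 2-LO colorable 3-uniform hypergraph with $V=V_B\cup V_U$ a disjoint union, and let $\varepsilon>0$. Let $c_U$ be a partial LO coloring of $H$ using colors from the set $C_U$ that only assigns colors to $V_U$, and let $c_B$ be an LO coloring of the induced hypergraph $H_B=(V_B,E(V_B))$ using colors from the set $C_B$. Then we can obtain an LO coloring of $H$ using at most $|C_U|+|C_B|$ colors.
   Context: A 3-uniform hypergraph has edges that are 3-element subsets of the vertex set. An LO coloring assigns colors from a linearly ordered set to all vertices so that in every edge the maximum color is attained by exactly one vertex; 2-LO colorable means such a coloring with 2 colors exists. A partial LO coloring of $H$ colors a subset $V_1\subseteq V$ with colors from a linearly ordered set so that for every edge $e$, the colors on $e\cap V_1$ have a unique maximum. For $S\subseteq V$, $E(S)=\{e\in E: e\subseteq S\}$ is the set of induced edges. -}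

module Defs where

open import Data.Nat using (ℕ; _+_)
open import Data.Fin using (Fin; _<_)
open import Data.Bool using (Bool; true; false)
open import Data.Maybe using (Maybe; just; nothing; Is-just)
open import Data.List using (List; []; _∷_; length; lookup; map; catMaybes)
open import Data.List.Relation.Unary.All using (All)
open import Data.Product using (Σ; _×_; _,_)
open import Relation.Binary.PropositionalEquality using (_≡_; _≢_)
open import Relation.Nullary using (¬_)

Edge : ℕ → Set
Edge n = Fin n × Fin n × Fin n

Distinct3 : ∀ {n} → Edge n → Set
Distinct3 (a , b , c) = (a ≢ b) × (a ≢ c) × (b ≢ c)

record Hypergraph3 : Set where
  field
    n        : ℕ
    edges    : List (Edge n)
    distinct : All Distinct3 edges

open Hypergraph3 public

vertsOf : ∀ {n} → Edge n → List (Fin n)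
vertsOf (a , b , c) = a ∷ b ∷ c ∷ []

UniqueMax : ∀ {k} → List (Fin k) → Set
UniqueMax xs = Σ (Fin (length xs)) λ i →
  ∀ (j : Fin (length xs)) → j ≢ i → lookup xs j < lookup xs i

IsLOColoring : (H : Hypergraph3) (k : ℕ) → (Fin (n H) → Fin k) → Set
IsLOColoring H k c = All (λ e → UniqueMax (map c (vertsOf e))) (edges H)

TwoLOColorable : Hypergraph3 → Set
TwoLOColorable H = Σ (Fin (n H) → Fin 2) λ c → IsLOColoring H 2 c

IsPartialLOColoring : (H : Hypergraph3) (k : ℕ) → (Fin (n H) → Maybe (Fin k)) → Set
IsPartialLOColoring H k c =
  All (λ e → ¬ (catMaybes (map c (vertsOf e)) ≡ []) →
             UniqueMax (catMaybes (map c (vertsOf e))))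
      (edges H)

_∈ₛ_ : ∀ {n} → Fin n → (Fin n → Bool) → Set
v ∈ₛ S = S v ≡ true

compl : ∀ {n} → (Fin n → Bool) → (Fin n → Bool)
compl S v with S v
... | true  = false
... | false = true

EdgeIn : ∀ {n} → (Fin n → Bool) → Edge n → Set
EdgeIn S e = All (λ v → v ∈ₛ S) (vertsOf e)

-- An LO coloring of the induced hypergraph H[S] = (S, E(S)), represented as a
-- map that is defined exactly on S (values outside S are `nothing`).
IsInducedLOColoring : (H : Hypergraph3) (S : Fin (n H) → Bool) (k : ℕ) →
                      (Fin (n H) → Maybe (Fin k)) → Set
IsInducedLOColoring H S k c =
  (∀ v → (v ∈ₛ S → Is-just (c v)) × (Is-just (c v) → v ∈ₛ S)) ×
  All (λ e → EdgeIn S e → UniqueMax (catMaybes (map c (vertsOf e)))) (edges H)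

{-# OPTIONS --safe #-}
-- Give each vertex of U its U-colour shifted above all kB colours of B, and every other vertex
-- (it lies in B) its B-colour. An edge meeting U takes its maximum among its U-coloured vertices,
-- where it is unique because c_U is a partial LO colouring, and all its B-vertices lie below;
-- an edge missing U is an edge of H[B], where c_B has a unique maximum.
module Submission where

open import Defs
open import Data.Bool using (Bool; true; false)
open import Data.Empty using (⊥-elim)
open import Data.Fin using (Fin; zero; suc; toℕ; cast; _↑ˡ_; _↑ʳ_; _<_)
open import Data.Fin.Properties using (toℕ<n; toℕ-cast; toℕ-↑ˡ; toℕ-↑ʳ)
open import Data.List using (List; []; _∷_; lookup; map; catMaybes)
open import Data.List.Membership.Propositional.Properties using (∈-lookup)
open import Data.List.Relation.Unary.All as All using (All; []; _∷_)
open import Data.List.Relation.Unary.All.Properties using (map⁻)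
open import Data.List.Relation.Unary.Any using (index)
open import Data.List.Relation.Unary.Any.Properties using (lookup-index)
open import Data.Maybe using (Maybe; just; nothing; Is-just; to-witness)
open import Data.Maybe.Relation.Unary.Any using (just)
open import Data.Nat using (ℕ; _+_) renaming (_<_ to _<ℕ_)
import Data.Nat.Properties as ℕ
open import Data.Product using (Σ; _×_; _,_; proj₁; proj₂; ∃)
open import Data.Sum as Sum using (_⊎_; inj₁; inj₂)
open import Function using (case_of_)
open import Relation.Binary.Core using (_Preserves_⟶_)
open import Relation.Binary.PropositionalEquality
  using (_≡_; _≢_; refl; sym; trans; cong; subst; subst₂)

data UniqueMaxIs {k} : List (Fin k) → Fin k → Set where
  here  : ∀ {x xs} → All (_< x) xs → UniqueMaxIs (x ∷ xs) x
  there : ∀ {x xs m} → x < m → UniqueMaxIs xs m → UniqueMaxIs (x ∷ xs) m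

module _ {k : ℕ} where

  uniqueMaxIs-lookup : ∀ {xs : List (Fin k)} i →
    (∀ j → j ≢ i → lookup xs j < lookup xs i) → UniqueMaxIs xs (lookup xs i)
  uniqueMaxIs-lookup {x ∷ xs} zero below = here (All.tabulate λ y∈xs →
    subst (_< x) (sym (lookup-index y∈xs)) (below (suc (index y∈xs)) λ ()))
  uniqueMaxIs-lookup {x ∷ xs} (suc i) below = there (below zero λ ())
    (uniqueMaxIs-lookup i λ j j≢i → below (suc j) λ { refl → j≢i refl })

  UniqueMax⇒UniqueMaxIs : ∀ {xs : List (Fin k)} → UniqueMax xs → ∃ (UniqueMaxIs xs)
  UniqueMax⇒UniqueMaxIs (i , below) = _ , uniqueMaxIs-lookup i below

  UniqueMaxIs⇒lookup : ∀ {xs : List (Fin k)} {m} → UniqueMaxIs xs m →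
    Σ (Fin _) λ i → lookup xs i ≡ m × (∀ j → j ≢ i → lookup xs j < m)
  UniqueMaxIs⇒lookup (here xs<x) = zero , refl , λ
    { zero 0≢0 → ⊥-elim (0≢0 refl)
    ; (suc j) _ → All.lookup xs<x (∈-lookup j) }
  UniqueMaxIs⇒lookup (there x<m max) with UniqueMaxIs⇒lookup max
  ... | i , refl , below = suc i , refl , λ
    { zero _ → x<m
    ; (suc j) sj≢si → below j λ j≡i → sj≢si (cong suc j≡i) }

  UniqueMaxIs⇒UniqueMax : ∀ {xs : List (Fin k)} {m} → UniqueMaxIs xs m → UniqueMax xs
  UniqueMaxIs⇒UniqueMax max with UniqueMaxIs⇒lookup max
  ... | i , refl , below = i , below

Extends : ∀ {k K} → (Fin k → Fin K) → Maybe (Fin k) → Fin K → Set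
Extends h (just x) c = c ≡ h x
Extends h nothing  c = ∀ x → c < h x

extends-to-witness : ∀ {k K} (h : Fin k → Fin K) {m} (p : Is-just m) →
  Extends h m (h (to-witness p))
extends-to-witness h (just _) = refl

module _ {V : Set} {k K : ℕ} {h : Fin k → Fin K} (h-mono : h Preserves _<_ ⟶ _<_)
         (u : V → Maybe (Fin k)) (c : V → Fin K) where

  extends-below : ∀ {vs x} → All (λ v → Extends h (u v) (c v)) vs →
    All (_< x) (catMaybes (map u vs)) → All (_< h x) (map c vs)
  extends-below {[]}     []       _ = []
  extends-below {v ∷ vs} (e ∷ es) below with u v
  ... | nothing = e _ ∷ extends-below es below
  ... | just y with below
  ...   | y<x ∷ below′ rewrite e = h-mono y<x ∷ extends-below es below′

  extends-uniqueMaxIs : ∀ {vs m} → All (λ v → Extends h (u v) (c v)) vs →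
    UniqueMaxIs (catMaybes (map u vs)) m → UniqueMaxIs (map c vs) (h m)
  extends-uniqueMaxIs {v ∷ vs} (e ∷ es) max with u v
  ... | nothing = there (e _) (extends-uniqueMaxIs es max)
  ... | just y with max
  ...   | here below     rewrite e = here (extends-below es below)
  ...   | there y<m max′ rewrite e = there (h-mono y<m) (extends-uniqueMaxIs es max′)

  extends-uniqueMax : ∀ {vs} → All (λ v → Extends h (u v) (c v)) vs →
    UniqueMax (catMaybes (map u vs)) → UniqueMax (map c vs)
  extends-uniqueMax es max =
    UniqueMaxIs⇒UniqueMax (extends-uniqueMaxIs es (proj₂ (UniqueMax⇒UniqueMaxIs max)))

all-nothing⊎catMaybes≢[] : ∀ {A : Set} (ms : List (Maybe A)) →
  All (_≡ nothing) ms ⊎ catMaybes ms ≢ []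
all-nothing⊎catMaybes≢[] []             = inj₁ []
all-nothing⊎catMaybes≢[] (just _ ∷ _)   = inj₂ λ ()
all-nothing⊎catMaybes≢[] (nothing ∷ ms) =
  Sum.map₁ (refl ∷_) (all-nothing⊎catMaybes≢[] ms)

module Layers (kU kB : ℕ) where

  Lo : Fin kB → Fin (kU + kB)
  Lo y = cast (ℕ.+-comm kB kU) (y ↑ˡ kU)

  Hi : Fin kU → Fin (kU + kB)
  Hi x = cast (ℕ.+-comm kB kU) (kB ↑ʳ x)

  toℕ-Lo : ∀ y → toℕ (Lo y) ≡ toℕ y
  toℕ-Lo y = trans (toℕ-cast _ (y ↑ˡ kU)) (toℕ-↑ˡ y kU)

  toℕ-Hi : ∀ x → toℕ (Hi x) ≡ kB + toℕ x
  toℕ-Hi x = trans (toℕ-cast _ (kB ↑ʳ x)) (toℕ-↑ʳ kB x)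

  Lo-mono : Lo Preserves _<_ ⟶ _<_
  Lo-mono {y} {y′} y<y′ = subst₂ _<ℕ_ (sym (toℕ-Lo y)) (sym (toℕ-Lo y′)) y<y′

  Hi-mono : Hi Preserves _<_ ⟶ _<_
  Hi-mono {x} {x′} x<x′ =
    subst₂ _<ℕ_ (sym (toℕ-Hi x)) (sym (toℕ-Hi x′)) (ℕ.+-monoʳ-< kB x<x′)

  Lo<Hi : ∀ y x → Lo y < Hi x
  Lo<Hi y x = subst₂ _<ℕ_ (sym (toℕ-Lo y)) (sym (toℕ-Hi x))
    (ℕ.<-≤-trans (toℕ<n y) (ℕ.m≤m+n kB (toℕ x)))

module Combination
  (H : Hypergraph3) (inU : Fin (n H) → Bool) (kU kB : ℕ)
  (cU : Fin (n H) → Maybe (Fin kU)) (partialU : IsPartialLOColoring H kU cU)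
  (domainU : ∀ v → (v ∈ₛ inU → Is-just (cU v)) × (Is-just (cU v) → v ∈ₛ inU))
  (cB : Fin (n H) → Maybe (Fin kB)) (inducedB : IsInducedLOColoring H (compl inU) kB cB)
  where

  open Layers kU kB

  uncoloured⇒∈B : ∀ v → cU v ≡ nothing → v ∈ₛ compl inU
  uncoloured⇒∈B v noU with inU v | proj₁ (domainU v)
  ... | false | _      = refl
  ... | true  | ∈U⇒cU = case subst Is-just noU (∈U⇒cU refl) of λ ()

  coloured-by-B : ∀ v → cU v ≡ nothing → Is-just (cB v)
  coloured-by-B v noU = proj₁ (proj₁ inducedB v) (uncoloured⇒∈B v noU)

  overlay : (u : Maybe (Fin kU)) → (u ≡ nothing → Fin kB) → Fin (kU + kB)
  overlay (just x) _ = Hi x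
  overlay nothing  b = Lo (b refl)

  overlay-nothing : ∀ {u} (b : u ≡ nothing → Fin kB) (noU : u ≡ nothing) →
    overlay u b ≡ Lo (b noU)
  overlay-nothing b refl = refl

  colour : Fin (n H) → Fin (kU + kB)
  colour v = overlay (cU v) (λ noU → to-witness (coloured-by-B v noU))

  overlay-extends-Hi : ∀ u b → Extends Hi u (overlay u b)
  overlay-extends-Hi (just _) _ = refl
  overlay-extends-Hi nothing  b = Lo<Hi (b refl)

  colour-extends-Hi : ∀ v → Extends Hi (cU v) (colour v)
  colour-extends-Hi v = overlay-extends-Hi (cU v) _

  colour-extends-Lo : ∀ v → cU v ≡ nothing → Extends Lo (cB v) (colour v)
  colour-extends-Lo v noU = subst (Extends Lo (cB v)) (sym (overlay-nothing _ noU))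
    (extends-to-witness Lo (coloured-by-B v noU))

  colour-isLOColoring : IsLOColoring H (kU + kB) colour
  colour-isLOColoring = All.zipWith edge (partialU , proj₂ inducedB)
    where
    edge : ∀ {e} →
      (catMaybes (map cU (vertsOf e)) ≢ [] → UniqueMax (catMaybes (map cU (vertsOf e)))) ×
      (EdgeIn (compl inU) e → UniqueMax (catMaybes (map cB (vertsOf e)))) →
      UniqueMax (map colour (vertsOf e))
    edge {e} (fromU , fromB) with all-nothing⊎catMaybes≢[] (map cU (vertsOf e))
    ... | inj₁ allNothing = let noUs = map⁻ allNothing in
      extends-uniqueMax Lo-mono cB colour (All.map (colour-extends-Lo _) noUs)
        (fromB (All.map (uncoloured⇒∈B _) noUs))
    ... | inj₂ someU =
      extends-uniqueMax Hi-mono cU colour (All.universal colour-extends-Hi (vertsOf e))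
        (fromU someU)

proposition7 : (H : Hypergraph3) → TwoLOColorable H →
    (inU : Fin (n H) → Bool) →
    (kU kB : ℕ) →
    (cU : Fin (n H) → Maybe (Fin kU)) →
    IsPartialLOColoring H kU cU →
    (∀ v → (v ∈ₛ inU → Is-just (cU v)) × (Is-just (cU v) → v ∈ₛ inU)) →
    (cB : Fin (n H) → Maybe (Fin kB)) →
    IsInducedLOColoring H (compl inU) kB cB →
    Σ (Fin (n H) → Fin (kU + kB)) λ c → IsLOColoring H (kU + kB) c
proposition7 H _ inU kU kB cU partialU domainU cB inducedB = colour , colour-isLOColoring
  where open Combination H inU kU kB cU partialU domainU cB inducedB
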